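{- Let $a,b$ be relatively prime positive integers, $n\ge1$, let $P$ be an $(a,b)$-Dyck path of size $n$ with step sequence $\mathbf{u}=(u_1,\dots,u_{an})$, let $w=\mu_b(\mathbf{u})$, for $i\in[1,b]$ let $\nu^i_j=w_{(j-1)b+i}$ ($1\le j\le an$) and $\xi^i=\mu_1^{ -1}(\nu^i)=(\xi^i_1,\dots,\xi^i_{an})$. For $i\in[1,b]$, $j\in[1,a]$ define $\rho^{i,j}=(\rho^{i,j}_1,\dots,\rho^{i,j}_n)$ by $\rho^{i,j}_k=\xi^i_{a(k-1)+j}$. Let $\vartheta_{i,j}$ be the $j$-th path of $\theta_v(p_i)$, where $\theta_h(P)=(p_1,\dots,p_b)$. Then $\rho^{i,j}$ is the step sequence of $\vartheta_{i,j}$ for all $i\in[1,b]$, $j\in[1,a]$.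
   Context: An $(a,b)$-Dyck path of size $n$ is a lattice path from $(0,0)$ to $(bn,an)$ with unit steps $N=(0,1)$, $E=(1,0)$ never going below $y=ax/b$. Step sequence of a path with $A$ north steps: $(u_1,\dots,u_A)$, $u_k$ the $x$-coordinate of the $k$-th north step. Height sequence of a path with $B$ east steps: $(h_1,\dots,h_B)$, $h_k$ the $y$-coordinate of the $k$-th east step. $\theta_h$: for a path from $(0,0)$ to $(bn,m)$ with height sequence $(h_1,\dots,h_{bn})$, $\theta_h$ returns paths $p_1,\dots,p_b$ from $(0,0)$ to $(n,m)$ with $p_i$ having height sequence $(h_{(k-1)b+i})_{k=1}^n$. $\theta_v$: for a path from $(0,0)$ to $(m,an)$ with step sequence $(u_1,\dots,u_{an})$, $\theta_v$ returns paths $q_1,\dots,q_a$ from $(0,0)$ to $(m,n)$ with $q_j$ having step sequence $(u_{(k-1)a+j})_{k=1}^n$. For a positive integer $c$, $\mu_c$ sends $(u_1,\dots,u_m)$ (nonnegative, $u_k\le c(k-1)$) to the word obtained from $1^c$ by inserting, for $k=2,\dots,m$, the block $k^c$ immediately after the first $u_k$ letters of the current word. For a permutation $w$ of $\{1,\dots,m\}$, $\mu_1^{ -1}(w)=(\xi_1,\dots,\xi_m)$ with $\xi_k$ the position of $k$ in the subword of $w$ formed by $1,\dots,k$, minus one. -}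

module Defs where

open import Data.Nat using (ℕ; zero; suc; _+_; _*_; _∸_; _≤_; _≤?_; _≟_)
open import Data.List using (List; []; _∷_; _++_; replicate; take; drop; length; filter; takeWhile)
open import Data.Vec using (Vec; tabulate)
open import Data.Fin using (Fin; toℕ)
open import Data.Product using (_×_)
open import Relation.Binary.PropositionalEquality using (_≡_)
open import Relation.Nullary.Decidable using (¬?)

-- Lattice paths as words in the unit steps N = (0,1) and E = (1,0).

data Step : Set where
  N E : Step

Path : Set
Path = List Step

#N : Path → ℕ
#N []       = 0
#N (N ∷ p)  = suc (#N p)
#N (E ∷ p)  = #N p

#E : Path → ℕ
#E []       = 0
#E (N ∷ p)  = #E p
#E (E ∷ p)  = suc (#E p)

-- Every lattice point (x , y) visited, starting at (x0 , y0), satisfies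
-- a x ≤ b y, i.e. lies weakly above y = a x / b.  (Segments between
-- consecutive lattice points then lie weakly above the line too.)
AboveFrom : ℕ → ℕ → ℕ → ℕ → Path → Set
AboveFrom a b x y []      = a * x ≤ b * y
AboveFrom a b x y (N ∷ p) = (a * x ≤ b * y) × AboveFrom a b x (suc y) p
AboveFrom a b x y (E ∷ p) = (a * x ≤ b * y) × AboveFrom a b (suc x) y p

record IsDyck (a b n : ℕ) (P : Path) : Set where
  field
    eastCount  : #E P ≡ b * n
    northCount : #N P ≡ a * n
    above      : AboveFrom a b 0 0 P

stepSeqFrom : ℕ → Path → List ℕ
stepSeqFrom x []      = []
stepSeqFrom x (N ∷ p) = x ∷ stepSeqFrom x p
stepSeqFrom x (E ∷ p) = stepSeqFrom (suc x) p

stepSeq : Path → List ℕ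
stepSeq = stepSeqFrom 0

heightSeqFrom : ℕ → Path → List ℕ
heightSeqFrom y []      = []
heightSeqFrom y (N ∷ p) = heightSeqFrom (suc y) p
heightSeqFrom y (E ∷ p) = y ∷ heightSeqFrom y p

heightSeq : Path → List ℕ
heightSeq = heightSeqFrom 0

pathFromHeightsFrom : ℕ → ℕ → List ℕ → Path
pathFromHeightsFrom m y []       = replicate (m ∸ y) N
pathFromHeightsFrom m y (h ∷ hs) = replicate (h ∸ y) N ++ (E ∷ pathFromHeightsFrom m h hs)

pathFromHeights : ℕ → List ℕ → Path
pathFromHeights m = pathFromHeightsFrom m 0

pathFromStepsFrom : ℕ → ℕ → List ℕ → Path
pathFromStepsFrom m x []       = replicate (m ∸ x) E
pathFromStepsFrom m x (u ∷ us) = replicate (u ∸ x) E ++ (N ∷ pathFromStepsFrom m u us)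

pathFromSteps : ℕ → List ℕ → Path
pathFromSteps m = pathFromStepsFrom m 0

-- sub c i l : the subsequence (l_{(k-1)c+i})_{k ≥ 1}, for 1 ≤ i ≤ c
-- (1-based indices), i.e. the entries of l at 0-based positions
-- i-1, i-1+c, i-1+2c, ...
subGo : ∀ {A : Set} → ℕ → ℕ → List A → List A
subGo c k       []       = []
subGo c zero    (x ∷ xs) = x ∷ subGo c (c ∸ 1) xs
subGo c (suc k) (x ∷ xs) = subGo c k xs

sub : ∀ {A : Set} → ℕ → ℕ → List A → List A
sub c i l = subGo c (i ∸ 1) l

thetaH : (b m : ℕ) → Path → Vec Path b
thetaH b m P = tabulate (λ (i : Fin b) → pathFromHeights m (sub b (suc (toℕ i)) (heightSeq P)))

thetaV : (a m : ℕ) → Path → Vec Path a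
thetaV a m Q = tabulate (λ (j : Fin a) → pathFromSteps m (sub a (suc (toℕ j)) (stepSeq Q)))

-- μ_c : (u_1,…,u_m) ↦ word obtained from 1^c by inserting, for k = 2..m,
-- the block k^c immediately after the first u_k letters of the current word.
muGo : ℕ → ℕ → List ℕ → List ℕ → List ℕ
muGo c k w []       = w
muGo c k w (u ∷ us) = muGo c (suc k) (take u w ++ replicate c k ++ drop u w) us

mu : ℕ → List ℕ → List ℕ
mu c []        = []
mu c (u₁ ∷ us) = muGo c 2 (replicate c 1) us

-- μ_1^{-1}(w) = (ξ_1,…,ξ_m), ξ_k = (position of k in the subword of w
-- formed by the letters 1,…,k) − 1  = number of letters of that subword
-- preceding k.
xiAt : List ℕ → ℕ → ℕ
xiAt w k = length (takeWhile (λ x → ¬? (x ≟ k)) (filter (λ x → x ≤? k) w))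

upFrom : ℕ → ℕ → List ℕ
upFrom s zero    = []
upFrom s (suc m) = s ∷ upFrom (suc s) m

-- applied to a word w which is a permutation of {1,…,m}, m = length w
muInv1 : List ℕ → List ℕ
muInv1 w = Data.List.map (xiAt w) (upFrom 1 (length w))

{-# OPTIONS --safe #-}
module Submission where

open import Defs
open import Data.Nat using (ℕ; zero; suc; _+_; _*_; _∸_; _≤_; _<_; z≤n; s≤s; _≤?_; _≟_; >-nonZero)
open import Data.Nat.Properties
open import Data.Nat.Coprimality using (Coprime)
open import Data.List using (List; []; _∷_; _++_; replicate; take; drop; length; filter; takeWhile; map)
open import Data.List.Properties
  using (length-++; length-take; ++-identityʳ; take++drop≡id;
         map-cong; filter-++; filter-all; filter-reject)
open import Data.List.Relation.Unary.All as All using (All; []; _∷_)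
open import Data.List.Relation.Unary.All.Properties using (take⁺; drop⁺; ++⁺)
open import Data.Vec using (lookup)
open import Data.Vec.Properties using (lookup∘tabulate)
open import Data.Fin using (Fin; toℕ)
open import Data.Fin.Properties using (toℕ<n)
open import Data.Product using (_×_; _,_)
open import Data.Unit using (⊤; tt)
open import Function using (_∘_)
open import Relation.Nullary using (yes; no; ¬_; contradiction)
open import Relation.Unary using (Pred; Decidable)
open import Relation.Nullary.Decidable using (¬?)
open import Relation.Binary.PropositionalEquality
open ≡-Reasoning

-- The i-th path of θ_h(P) is P with all east steps deleted except those of index ≡ i (mod b);
-- this moves a north step at x-coordinate u to subCount b (i-1) u, the number of kept east steps
-- among the first u.  Keeping every b-th letter of μ_b(u) likewise shrinks each inserted block
-- k^b to a single letter k, inserted after subCount b (i-1) u_k letters, so that subword is μ₁ of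
-- the same counted sequence, and μ₁⁻¹ undoes μ₁.  Both sides then take every a-th entry.

-- subCount c k x is the length of subGo c k l for any list l of length x.
subCount : ℕ → ℕ → ℕ → ℕ
subCount c k       zero    = zero
subCount c zero    (suc x) = suc (subCount c (c ∸ 1) x)
subCount c (suc k) (suc x) = subCount c k x

subCount-mono : ∀ c k {x y} → x ≤ y → subCount c k x ≤ subCount c k y
subCount-mono c k       {zero}           _         = z≤n
subCount-mono c zero    {suc x} {suc y} (s≤s x≤y) = s≤s (subCount-mono c (c ∸ 1) x≤y)
subCount-mono c (suc k) {suc x} {suc y} (s≤s x≤y) = subCount-mono c k x≤y

subCount-shift : ∀ c e k x → subCount c (e + k) (e + x) ≡ subCount c k x
subCount-shift c zero    k x = refl
subCount-shift c (suc e) k x = subCount-shift c e k x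

subCount-period : ∀ d k x → k ≤ d → subCount (suc d) k (suc d + x) ≡ suc (subCount (suc d) k x)
subCount-period d k x k≤d = begin
  subCount c k (suc d + x)
    ≡⟨ cong₂ (subCount c) (sym (+-identityʳ k)) period ⟩
  subCount c (k + 0) (k + suc (e + x))
    ≡⟨ subCount-shift c k 0 (suc (e + x)) ⟩
  suc (subCount c d (e + x))
    ≡⟨ cong (λ z → suc (subCount c z (e + x))) (sym (m∸n+n≡m k≤d)) ⟩
  suc (subCount c (e + k) (e + x))
    ≡⟨ cong suc (subCount-shift c e k x) ⟩
  suc (subCount c k x) ∎
  where
  c e : ℕ
  c = suc d
  e = d ∸ k
  period : suc d + x ≡ k + suc (e + x)
  period = begin
    suc d + x           ≡⟨ cong (λ z → suc z + x) (sym (m+[n∸m]≡n k≤d)) ⟩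
    suc (k + e + x)     ≡⟨ cong suc (+-assoc k e x) ⟩
    suc (k + (e + x))   ≡⟨ sym (+-suc k (e + x)) ⟩
    k + suc (e + x)     ∎

insertAt : ∀ {A : Set} → ℕ → List A → List A → List A
insertAt p ys xs = take p xs ++ ys ++ drop p xs

insertAt-[] : ∀ {A : Set} p (ys : List A) → insertAt p ys [] ≡ ys
insertAt-[] zero    ys = ++-identityʳ ys
insertAt-[] (suc p) ys = ++-identityʳ ys

length-insertAt : ∀ {A : Set} p (ys xs : List A) → length (insertAt p ys xs) ≡ length ys + length xs
length-insertAt zero    ys xs       = length-++ ys
length-insertAt (suc p) ys []       = length-++ ys
length-insertAt (suc p) ys (x ∷ xs) = trans (cong suc (length-insertAt p ys xs)) (sym (+-suc _ _))

subGo-replicate-skip : ∀ {A : Set} c e k (x : A) W → e ≤ k →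
  subGo c k (replicate e x ++ W) ≡ subGo c (k ∸ e) W
subGo-replicate-skip c zero    k       x W _         = refl
subGo-replicate-skip c (suc e) (suc k) x W (s≤s e≤k) = subGo-replicate-skip c e k x W e≤k

subGo-replicate-keep : ∀ {A : Set} c k e (x : A) W → k ≤ e → e ≤ c ∸ 1 →
  subGo c k (replicate (suc e) x ++ W) ≡ x ∷ subGo c (c ∸ 1 ∸ (e ∸ k)) W
subGo-replicate-keep c zero    e       x W _         e<c =
  cong (x ∷_) (subGo-replicate-skip c e (c ∸ 1) x W e<c)
subGo-replicate-keep c (suc k) (suc e) x W (s≤s k≤e) e<c =
  subGo-replicate-keep c k e x W k≤e (≤-trans (n≤1+n e) e<c)

subGo-block : ∀ {A : Set} d k (x : A) W → k ≤ d →
  subGo (suc d) k (replicate (suc d) x ++ W) ≡ x ∷ subGo (suc d) k W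
subGo-block d k x W k≤d =
  trans (subGo-replicate-keep (suc d) k d x W k≤d ≤-refl)
        (cong (λ z → x ∷ subGo (suc d) z W) (m∸[m∸n]≡n k≤d))

subGo-insertAt-block : ∀ {A : Set} d k p (x : A) W → k ≤ d →
  subGo (suc d) k (insertAt p (replicate (suc d) x) W)
    ≡ insertAt (subCount (suc d) k p) (x ∷ []) (subGo (suc d) k W)
subGo-insertAt-block d k       zero    x W       k≤d = subGo-block d k x W k≤d
subGo-insertAt-block d k       (suc p) x []      k≤d =
  trans (subGo-block d k x [] k≤d) (sym (insertAt-[] (subCount (suc d) k (suc p)) (x ∷ [])))
subGo-insertAt-block d zero    (suc p) x (w ∷ W) k≤d =
  cong (w ∷_) (subGo-insertAt-block d d p x W ≤-refl)
subGo-insertAt-block d (suc k) (suc p) x (w ∷ W) k≤d =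
  subGo-insertAt-block d k p x W (≤-trans (n≤1+n k) k≤d)

-- Admissible c 0 (u₁,…,u_m) is the domain condition u_k ≤ c(k-1) of μ_c.
Admissible : ℕ → ℕ → List ℕ → Set
Admissible c L []       = ⊤
Admissible c L (u ∷ us) = u ≤ L × Admissible c (c + L) us

admissible-subCount : ∀ d k L us → k ≤ d → Admissible (suc d) L us →
  Admissible 1 (subCount (suc d) k L) (map (subCount (suc d) k) us)
admissible-subCount d k L []       k≤d tt          = tt
admissible-subCount d k L (u ∷ us) k≤d (u≤L , adm) =
  subCount-mono (suc d) k u≤L ,
  subst (λ M → Admissible 1 M (map (subCount (suc d) k) us))
        (subCount-period d k L k≤d)
        (admissible-subCount d k (suc d + L) us k≤d adm)

subGo-muGo : ∀ d k m w us → k ≤ d →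
  subGo (suc d) k (muGo (suc d) m w us) ≡ muGo 1 m (subGo (suc d) k w) (map (subCount (suc d) k) us)
subGo-muGo d k m w []       k≤d = refl
subGo-muGo d k m w (u ∷ us) k≤d =
  trans (subGo-muGo d k (suc m) (insertAt u (replicate (suc d) m) w) us k≤d)
        (cong (λ z → muGo 1 (suc m) z (map (subCount (suc d) k) us)) (subGo-insertAt-block d k u m w k≤d))

subGo-mu : ∀ d k us → k ≤ d → subGo (suc d) k (mu (suc d) us) ≡ mu 1 (map (subCount (suc d) k) us)
subGo-mu d k []        k≤d = refl
subGo-mu d k (u₁ ∷ us) k≤d =
  trans (subGo-muGo d k 2 (replicate (suc d) 1) us k≤d)
        (cong (λ z → muGo 1 2 z (map (subCount (suc d) k) us)) ones)
  where
  ones : subGo (suc d) k (replicate (suc d) 1) ≡ 1 ∷ []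
  ones = trans (cong (subGo (suc d) k) (sym (++-identityʳ (replicate (suc d) 1))))
               (subGo-block d k 1 [] k≤d)

filter-insertAt-greater : ∀ ℓ k v w → ℓ < k →
  filter (_≤? ℓ) (insertAt v (k ∷ []) w) ≡ filter (_≤? ℓ) w
filter-insertAt-greater ℓ k v w ℓ<k = begin
  filter (_≤? ℓ) (take v w ++ k ∷ drop v w)
    ≡⟨ filter-++ (_≤? ℓ) (take v w) (k ∷ drop v w) ⟩
  filter (_≤? ℓ) (take v w) ++ filter (_≤? ℓ) (k ∷ drop v w)
    ≡⟨ cong (filter (_≤? ℓ) (take v w) ++_) (filter-reject (_≤? ℓ) (<⇒≱ ℓ<k)) ⟩
  filter (_≤? ℓ) (take v w) ++ filter (_≤? ℓ) (drop v w)
    ≡⟨ sym (filter-++ (_≤? ℓ) (take v w) (drop v w)) ⟩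
  filter (_≤? ℓ) (take v w ++ drop v w)
    ≡⟨ cong (filter (_≤? ℓ)) (take++drop≡id v w) ⟩
  filter (_≤? ℓ) w ∎

xiAt-muGo : ∀ ℓ k w vs → ℓ < k → xiAt (muGo 1 k w vs) ℓ ≡ xiAt w ℓ
xiAt-muGo ℓ k w []       ℓ<k = refl
xiAt-muGo ℓ k w (v ∷ vs) ℓ<k =
  trans (xiAt-muGo ℓ (suc k) (insertAt v (k ∷ []) w) vs (m<n⇒m<1+n ℓ<k))
        (cong (length ∘ takeWhile (λ x → ¬? (x ≟ ℓ))) (filter-insertAt-greater ℓ k v w ℓ<k))

takeWhile-++-reject : ∀ {a p} {A : Set a} {P : Pred A p} (P? : Decidable P) xs {y : A} ys →
  All P xs → ¬ P y → takeWhile P? (xs ++ y ∷ ys) ≡ xs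
takeWhile-++-reject P? [] {y} ys [] ¬py with P? y
... | yes py = contradiction py ¬py
... | no _   = refl
takeWhile-++-reject P? (x ∷ xs) ys (px ∷ pxs) ¬py with P? x
... | yes _  = cong (x ∷_) (takeWhile-++-reject P? xs ys pxs ¬py)
... | no ¬px = contradiction px ¬px

xiAt-insertAt : ∀ k v w → All (_< k) w → v ≤ length w → xiAt (insertAt v (k ∷ []) w) k ≡ v
xiAt-insertAt k v w w<k v≤∣w∣ = begin
  length (takeWhile (λ x → ¬? (x ≟ k)) (filter (_≤? k) (take v w ++ k ∷ drop v w)))
    ≡⟨ cong (length ∘ takeWhile (λ x → ¬? (x ≟ k))) (filter-all (_≤? k) all≤k) ⟩
  length (takeWhile (λ x → ¬? (x ≟ k)) (take v w ++ k ∷ drop v w))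
    ≡⟨ cong length (takeWhile-++-reject (λ x → ¬? (x ≟ k)) (take v w) (drop v w)
                      (All.map <⇒≢ (take⁺ v w<k)) (λ k≢k → k≢k refl)) ⟩
  length (take v w)
    ≡⟨ trans (length-take v w) (m≤n⇒m⊓n≡m v≤∣w∣) ⟩
  v ∎
  where
  all≤k : All (_≤ k) (take v w ++ k ∷ drop v w)
  all≤k = ++⁺ (All.map <⇒≤ (take⁺ v w<k)) (≤-refl ∷ All.map <⇒≤ (drop⁺ v w<k))

all-insertAt : ∀ k v w → All (_< k) w → All (_< suc k) (insertAt v (k ∷ []) w)
all-insertAt k v w w<k =
  ++⁺ (All.map m<n⇒m<1+n (take⁺ v w<k)) (n<1+n k ∷ All.map m<n⇒m<1+n (drop⁺ v w<k))

xiAt-muGo-upFrom : ∀ k w vs → All (_< k) w → Admissible 1 (length w) vs →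
  map (xiAt (muGo 1 k w vs)) (upFrom k (length vs)) ≡ vs
xiAt-muGo-upFrom k w []       w<k tt               = refl
xiAt-muGo-upFrom k w (v ∷ vs) w<k (v≤∣w∣ , adm) = cong₂ _∷_
  (trans (xiAt-muGo k (suc k) w′ vs (n<1+n k)) (xiAt-insertAt k v w w<k v≤∣w∣))
  (xiAt-muGo-upFrom (suc k) w′ vs (all-insertAt k v w w<k)
     (subst (λ L → Admissible 1 L vs) (sym (length-insertAt v (k ∷ []) w)) adm))
  where
  w′ : List ℕ
  w′ = insertAt v (k ∷ []) w

length-muGo₁ : ∀ k w vs → length (muGo 1 k w vs) ≡ length vs + length w
length-muGo₁ k w []       = refl
length-muGo₁ k w (v ∷ vs) =
  trans (length-muGo₁ (suc k) (insertAt v (k ∷ []) w) vs)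
        (trans (cong (length vs +_) (length-insertAt v (k ∷ []) w)) (+-suc _ _))

muInv1-mu₁ : ∀ us → Admissible 1 0 us → muInv1 (mu 1 us) ≡ us
muInv1-mu₁ []             tt          = refl
muInv1-mu₁ (.0 ∷ us) (z≤n , adm)
  rewrite trans (length-muGo₁ 2 (1 ∷ []) us) (+-comm (length us) 1) =
  cong₂ _∷_ (xiAt-muGo 1 2 (1 ∷ []) us (n<1+n 1))
            (xiAt-muGo-upFrom 2 (1 ∷ []) us (n<1+n 1 ∷ []) adm)

eastSub : ℕ → ℕ → Path → Path
eastSub b k       []      = []
eastSub b k       (N ∷ P) = N ∷ eastSub b k P
eastSub b zero    (E ∷ P) = E ∷ eastSub b (b ∸ 1) P
eastSub b (suc k) (E ∷ P) = eastSub b k P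

#N-eastSub : ∀ b k P → #N (eastSub b k P) ≡ #N P
#N-eastSub b k       []      = refl
#N-eastSub b k       (N ∷ P) = cong suc (#N-eastSub b k P)
#N-eastSub b zero    (E ∷ P) = #N-eastSub b (b ∸ 1) P
#N-eastSub b (suc k) (E ∷ P) = #N-eastSub b k P

heightSeqFrom-eastSub : ∀ b k y P → heightSeqFrom y (eastSub b k P) ≡ subGo b k (heightSeqFrom y P)
heightSeqFrom-eastSub b k       y []      = refl
heightSeqFrom-eastSub b k       y (N ∷ P) = heightSeqFrom-eastSub b k (suc y) P
heightSeqFrom-eastSub b zero    y (E ∷ P) = cong (y ∷_) (heightSeqFrom-eastSub b (b ∸ 1) y P)
heightSeqFrom-eastSub b (suc k) y (E ∷ P) = heightSeqFrom-eastSub b k y P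

replicate-snoc : ∀ {A : Set} e (x : A) xs → replicate e x ++ x ∷ xs ≡ x ∷ replicate e x ++ xs
replicate-snoc zero    x xs = refl
replicate-snoc (suc e) x xs = cong (x ∷_) (replicate-snoc e x xs)

pathFromHeightsFrom-heightSeqFrom : ∀ m e y Q → e + y + #N Q ≡ m →
  pathFromHeightsFrom m y (heightSeqFrom (e + y) Q) ≡ replicate e N ++ Q
pathFromHeightsFrom-heightSeqFrom m e y [] eq =
  trans (cong (λ z → replicate (z ∸ y) N) (trans (sym eq) (+-identityʳ (e + y))))
        (trans (cong (λ z → replicate z N) (m+n∸n≡m e y)) (sym (++-identityʳ _)))
pathFromHeightsFrom-heightSeqFrom m e y (N ∷ Q) eq =
  trans (pathFromHeightsFrom-heightSeqFrom m (suc e) y Q (trans (sym (+-suc (e + y) (#N Q))) eq))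
        (sym (replicate-snoc e N Q))
pathFromHeightsFrom-heightSeqFrom m e y (E ∷ Q) eq =
  cong₂ (λ z rest → replicate z N ++ E ∷ rest) (m+n∸n≡m e y)
        (pathFromHeightsFrom-heightSeqFrom m 0 (e + y) Q eq)

pathFromHeights-heightSeq : ∀ Q → pathFromHeights (#N Q) (heightSeq Q) ≡ Q
pathFromHeights-heightSeq Q = pathFromHeightsFrom-heightSeqFrom (#N Q) 0 0 Q refl

map-stepSeqFrom-suc : ∀ (f : ℕ → ℕ) x P → map f (stepSeqFrom (suc x) P) ≡ map (f ∘ suc) (stepSeqFrom x P)
map-stepSeqFrom-suc f x []      = refl
map-stepSeqFrom-suc f x (N ∷ P) = cong (f (suc x) ∷_) (map-stepSeqFrom-suc f x P)
map-stepSeqFrom-suc f x (E ∷ P) = map-stepSeqFrom-suc f (suc x) P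

stepSeqFrom-eastSub : ∀ b k x P →
  stepSeqFrom x (eastSub b k P) ≡ map (λ z → x + subCount b k z) (stepSeq P)
stepSeqFrom-eastSub b k       x []      = refl
stepSeqFrom-eastSub b k       x (N ∷ P) = cong₂ _∷_ (sym (+-identityʳ x)) (stepSeqFrom-eastSub b k x P)
stepSeqFrom-eastSub b zero    x (E ∷ P) =
  trans (stepSeqFrom-eastSub b (b ∸ 1) (suc x) P)
        (trans (map-cong (λ z → sym (+-suc x (subCount b (b ∸ 1) z))) (stepSeq P))
               (sym (map-stepSeqFrom-suc (λ z → x + subCount b zero z) 0 P)))
stepSeqFrom-eastSub b (suc k) x (E ∷ P) =
  trans (stepSeqFrom-eastSub b k x P) (sym (map-stepSeqFrom-suc (λ z → x + subCount b (suc k) z) 0 P))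

stepSeq-eastSub : ∀ b k P → stepSeq (eastSub b k P) ≡ map (subCount b k) (stepSeq P)
stepSeq-eastSub b k P = stepSeqFrom-eastSub b k 0 P

SortedFrom : ℕ → List ℕ → Set
SortedFrom x []       = ⊤
SortedFrom x (v ∷ vs) = x ≤ v × SortedFrom v vs

sortedFrom-weaken : ∀ {x y} vs → x ≤ y → SortedFrom y vs → SortedFrom x vs
sortedFrom-weaken []       x≤y _              = tt
sortedFrom-weaken (v ∷ vs) x≤y (y≤v , sorted) = ≤-trans x≤y y≤v , sorted

sortedFrom-stepSeqFrom : ∀ x P → SortedFrom x (stepSeqFrom x P)
sortedFrom-stepSeqFrom x []      = tt
sortedFrom-stepSeqFrom x (N ∷ P) = ≤-refl , sortedFrom-stepSeqFrom x P
sortedFrom-stepSeqFrom x (E ∷ P) = sortedFrom-weaken _ (n≤1+n x) (sortedFrom-stepSeqFrom (suc x) P)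

sortedFrom-subGo : ∀ c k x vs → SortedFrom x vs → SortedFrom x (subGo c k vs)
sortedFrom-subGo c k       x []       _              = tt
sortedFrom-subGo c zero    x (v ∷ vs) (x≤v , sorted) = x≤v , sortedFrom-subGo c (c ∸ 1) v vs sorted
sortedFrom-subGo c (suc k) x (v ∷ vs) (x≤v , sorted) =
  sortedFrom-subGo c k x vs (sortedFrom-weaken vs x≤v sorted)

stepSeqFrom-replicate-E-++ : ∀ x e Q → stepSeqFrom x (replicate e E ++ Q) ≡ stepSeqFrom (e + x) Q
stepSeqFrom-replicate-E-++ x zero    Q = refl
stepSeqFrom-replicate-E-++ x (suc e) Q =
  trans (stepSeqFrom-replicate-E-++ (suc x) e Q) (cong (λ z → stepSeqFrom z Q) (+-suc e x))

stepSeqFrom-pathFromStepsFrom : ∀ m x vs → SortedFrom x vs →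
  stepSeqFrom x (pathFromStepsFrom m x vs) ≡ vs
stepSeqFrom-pathFromStepsFrom m x [] _ =
  trans (cong (stepSeqFrom x) (sym (++-identityʳ (replicate (m ∸ x) E))))
        (stepSeqFrom-replicate-E-++ x (m ∸ x) [])
stepSeqFrom-pathFromStepsFrom m x (v ∷ vs) (x≤v , sorted) =
  trans (stepSeqFrom-replicate-E-++ x (v ∸ x) (N ∷ pathFromStepsFrom m v vs))
        (trans (cong (λ z → z ∷ stepSeqFrom z (pathFromStepsFrom m v vs)) (m∸n+n≡m x≤v))
               (cong (v ∷_) (stepSeqFrom-pathFromStepsFrom m v vs sorted)))

admissible-stepSeqFrom : ∀ a b x y P → 1 ≤ a → AboveFrom a b x y P →
  Admissible b (y * b) (stepSeqFrom x P)
admissible-stepSeqFrom a b x y []      1≤a _              = tt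
admissible-stepSeqFrom a b x y (N ∷ P) 1≤a (ax≤by , above) =
  ≤-trans (m≤n*m x a {{>-nonZero 1≤a}}) (subst (a * x ≤_) (*-comm b y) ax≤by) ,
  admissible-stepSeqFrom a b x (suc y) P 1≤a above
admissible-stepSeqFrom a b x y (E ∷ P) 1≤a (_ , above) = admissible-stepSeqFrom a b (suc x) y P 1≤a above

lookup-thetaH : ∀ b P (i : Fin b) → lookup (thetaH b (#N P) P) i ≡ eastSub b (toℕ i) P
lookup-thetaH b P i = begin
  lookup (thetaH b (#N P) P) i
    ≡⟨ lookup∘tabulate _ i ⟩
  pathFromHeights (#N P) (subGo b k (heightSeq P))
    ≡⟨ cong (pathFromHeights (#N P)) (sym (heightSeqFrom-eastSub b k 0 P)) ⟩
  pathFromHeights (#N P) (heightSeq (eastSub b k P))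
    ≡⟨ cong (λ m → pathFromHeights m (heightSeq (eastSub b k P))) (sym (#N-eastSub b k P)) ⟩
  pathFromHeights (#N (eastSub b k P)) (heightSeq (eastSub b k P))
    ≡⟨ pathFromHeights-heightSeq (eastSub b k P) ⟩
  eastSub b k P ∎
  where
  k : ℕ
  k = toℕ i

stepSeq-lookup-thetaV : ∀ a m Q (j : Fin a) →
  stepSeq (lookup (thetaV a m Q) j) ≡ sub a (suc (toℕ j)) (stepSeq Q)
stepSeq-lookup-thetaV a m Q j =
  trans (cong stepSeq (lookup∘tabulate _ j))
        (stepSeqFrom-pathFromStepsFrom m 0 _ (sortedFrom-subGo a (toℕ j) 0 _ (sortedFrom-stepSeqFrom 0 Q)))

mainTheorem7 : (a b n : ℕ) → 1 ≤ a → 1 ≤ b → Coprime a b → 1 ≤ n →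
    (P : Path) → IsDyck a b n P →
    (i : Fin b) (j : Fin a) →
    stepSeq (lookup (thetaV a n (lookup (thetaH b (a * n) P) i)) j)
      ≡ sub a (suc (toℕ j)) (muInv1 (sub b (suc (toℕ i)) (mu b (stepSeq P))))
mainTheorem7 a zero    n _   ()  _ _ P dyck i j
mainTheorem7 a (suc d) n 1≤a _   _ _ P dyck i j = begin
  stepSeq (lookup (thetaV a n (lookup (thetaH (suc d) (a * n) P) i)) j)
    ≡⟨ stepSeq-lookup-thetaV a n (lookup (thetaH (suc d) (a * n) P) i) j ⟩
  subₐ (stepSeq (lookup (thetaH (suc d) (a * n) P) i))
    ≡⟨ cong (λ m → subₐ (stepSeq (lookup (thetaH (suc d) m P) i))) (sym (IsDyck.northCount dyck)) ⟩
  subₐ (stepSeq (lookup (thetaH (suc d) (#N P) P) i))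
    ≡⟨ cong (subₐ ∘ stepSeq) (lookup-thetaH (suc d) P i) ⟩
  subₐ (stepSeq (eastSub (suc d) k P))
    ≡⟨ cong subₐ (stepSeq-eastSub (suc d) k P) ⟩
  subₐ (map (subCount (suc d) k) (stepSeq P))
    ≡⟨ cong subₐ (sym (muInv1-mu₁ _ admissible)) ⟩
  subₐ (muInv1 (mu 1 (map (subCount (suc d) k) (stepSeq P))))
    ≡⟨ cong (subₐ ∘ muInv1) (sym (subGo-mu d k (stepSeq P) k≤d)) ⟩
  subₐ (muInv1 (sub (suc d) (suc k) (mu (suc d) (stepSeq P)))) ∎
  where
  k : ℕ
  k = toℕ i
  k≤d : k ≤ d
  k≤d = ≤-pred (toℕ<n i)
  subₐ : List ℕ → List ℕ
  subₐ = sub a (suc (toℕ j))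
  admissible : Admissible 1 0 (map (subCount (suc d) k) (stepSeq P))
  admissible = admissible-subCount d k 0 (stepSeq P) k≤d
                 (admissible-stepSeqFrom a (suc d) 0 0 P 1≤a (IsDyck.above dyck))
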